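{- Let $\mathcal{R}=(\mathcal{F},R)$ be an $(\mathbb{\Omega},\mathbb{\Phi})$-TRS, $t,s$ terms and $\varepsilon\in\Omega$. If $t\leftrightarrow^*_{R,\varepsilon}s$, then $\varepsilon\Vdash s=_R t$.
   Context: $\mathbb{\Omega}=(\Omega,\precsim,\otimes,\kappa)$ is a fixed Lawverean quantale (commutative monoid with complete lattice order $\precsim$, $\otimes$ distributing over arbitrary joins, $\kappa$ top, $\kappa\neq\bot$, cointegral). A CBE is a monotone map $\Omega\to\Omega$ preserving $\kappa$, $\otimes$ and arbitrary joins; $\mathbb{\Phi}$ is a fixed set of CBEs containing identity $\mathbb{1}$ and constant $\kappa^\star$, closed under composition and pointwise $\otimes$. A $\mathbb{\Phi}$-graded signature gives each $n$-ary $f$ a modal arity $(\phi_1,\dots,\phi_n)\in\Phi^n$; grade of a position: $\partial_\lambda(t)=\mathbb{1}$, $\partial_{i.p}(f(t_1,\dots,t_n))=\phi_i\circ\partial_p(t_i)$. An $(\mathbb{\Omega},\mathbb{\Phi})$-TRS $\mathcal{R}=(\mathcal{F},R)$: graded signature with rules $\varepsilon\Vdash l\mapsto r$, $l\notin\mathcal{V}$, $\mathcal{V}(r)\subseteq\mathcal{V}(l)$. Rewrite steps $\partial_p(u)(\varepsilon)\Vdash u[l\sigma]_p\to_R u[r\sigma]_p$; $u\leftrightarrow_{R,\gamma}u'$ iff $u\to_{R,\gamma}u'$ or $u'\to_{R,\gamma}u$; $\leftrightarrow^*_{R,\varepsilon}$: finite sequence of such steps (empty allowed, degree $\kappa$)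 with tensor product of degrees $\varepsilon$. $=_R$ is the graded equational theory presented by $R$: the least set of triples $\varepsilon\Vdash t=_R s$ containing $\varepsilon\Vdash l=_R r$ for every rule $\varepsilon\Vdash l\mapsto r$ and closed under (Refl) $\kappa\Vdash t=_R t$; (Sym); (Trans) $\varepsilon\Vdash t=_R s,\ \delta\Vdash s=_R r\Rightarrow\varepsilon\otimes\delta\Vdash t=_R r$; (Ampl) $\varepsilon_i\Vdash t_i=_R s_i$, $f:(\phi_1,\dots,\phi_n)\Rightarrow\phi_1(\varepsilon_1)\otimes\cdots\otimes\phi_n(\varepsilon_n)\Vdash f(t_1,\dots,t_n)=_R f(s_1,\dots,s_n)$; (Subst) $\varepsilon\Vdash t=_R s\Rightarrow\varepsilon\Vdash t\sigma=_R s\sigma$; (Ord) $\varepsilon\Vdash t=_R s,\ \delta\precsim\varepsilon\Rightarrow\delta\Vdash t=_R s$; (Join) $\varepsilon_i\Vdash t=_R s$ ($i=1..n$) $\Rightarrow\bigvee_i\varepsilon_i\Vdash t=_R s$. -}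

module Defs where

open import Data.Nat using (ℕ; zero; suc)
open import Data.Fin using (Fin; zero; suc; _≟_)
open import Data.Empty using (⊥)
open import Data.Product using (Σ; ∃; _×_; _,_)
open import Relation.Nullary using (¬_; yes; no)
open import Relation.Binary.PropositionalEquality using (_≡_; _≢_)

record Quantale : Set₁ where
  infix  4 _≾_
  infixl 7 _⊗_
  field
    Ω         : Set
    _≾_       : Ω → Ω → Set
    ≾-refl    : ∀ {a} → a ≾ a
    ≾-trans   : ∀ {a b c} → a ≾ b → b ≾ c → a ≾ c
    ≾-antisym : ∀ {a b} → a ≾ b → b ≾ a → a ≡ b
    ⋁         : {I : Set} → (I → Ω) → Ω
    ⋁-ub      : ∀ {I : Set} (f : I → Ω) (i : I) → f i ≾ ⋁ f
    ⋁-least   : ∀ {I : Set} (f : I → Ω) (a : Ω) → (∀ i → f i ≾ a) → ⋁ f ≾ a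
    _⊗_       : Ω → Ω → Ω
    κ         : Ω
    ⊗-assoc   : ∀ a b c → (a ⊗ b) ⊗ c ≡ a ⊗ (b ⊗ c)
    ⊗-comm    : ∀ a b → a ⊗ b ≡ b ⊗ a
    ⊗-identityˡ : ∀ a → κ ⊗ a ≡ a
    ⊗-distrib-⋁ : ∀ {I : Set} (a : Ω) (f : I → Ω) → a ⊗ ⋁ f ≡ ⋁ (λ i → a ⊗ f i)
    κ-top     : ∀ a → a ≾ κ
    κ≢⊥       : κ ≢ ⋁ {⊥} (λ ())

  ⊥Ω : Ω
  ⊥Ω = ⋁ {⊥} (λ ())

module _ (Q : Quantale) where
  open Quantale Q

  record IsCBE (φ : Ω → Ω) : Set₁ where
    field
      mono     : ∀ {a b} → a ≾ b → φ a ≾ φ b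
      pres-κ   : φ κ ≡ κ
      pres-⊗   : ∀ a b → φ (a ⊗ b) ≡ φ a ⊗ φ b
      -- joins of inhabited families
      pres-⋁   : ∀ {I : Set} (f : I → Ω) → I → φ (⋁ f) ≡ ⋁ (λ i → φ (f i))

  record GradeSet : Set₁ where
    field
      Φ        : (Ω → Ω) → Set
      Φ-CBE    : ∀ {φ} → Φ φ → IsCBE φ
      Φ-id     : Φ (λ a → a)
      Φ-const  : Φ (λ _ → κ)
      Φ-∘      : ∀ {φ ψ} → Φ φ → Φ ψ → Φ (λ a → φ (ψ a))
      Φ-⊗      : ∀ {φ ψ} → Φ φ → Φ ψ → Φ (λ a → φ a ⊗ ψ a)

  ⨂ : ∀ n → (Fin n → Ω) → Ω
  ⨂ zero    f = κ
  ⨂ (suc n) f = f zero ⊗ ⨂ n (λ i → f (suc i))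

module _ (Q : Quantale) (G : GradeSet Q) where
  open Quantale Q
  open GradeSet G

  record Signature : Set₁ where
    field
      Sym      : Set
      ar       : Sym → ℕ
      modal    : (f : Sym) → Fin (ar f) → Ω → Ω
      modal-Φ  : ∀ f i → Φ (modal f i)
      V        : Set

module Terms {Q : Quantale} {G : GradeSet Q} (S : Signature Q G) where
  open Quantale Q
  open Signature S

  data Term : Set where
    var : V → Term
    fun : (f : Sym) → (Fin (ar f) → Term) → Term

  data Pos : Term → Set where
    here  : ∀ {t} → Pos t
    there : ∀ {f ts} (i : Fin (ar f)) → Pos (ts i) → Pos (fun f ts)

  replace : (u : Term) → Pos u → Term → Term
  replace u here t = t
  replace (fun f ts) (there i p) t = fun f upd
    where
      upd : Fin (ar f) → Term
      upd j with j ≟ i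
      ... | yes _ = replace (ts i) p t
      ... | no  _ = ts j

  ∂ : (u : Term) → Pos u → Ω → Ω
  ∂ u here = λ a → a
  ∂ (fun f ts) (there i p) = λ a → modal f i (∂ (ts i) p a)

  _[_] : Term → (V → Term) → Term
  var x    [ σ ] = σ x
  fun f ts [ σ ] = fun f (λ i → ts i [ σ ])

  data _∈v_ (x : V) : Term → Set where
    at-var : x ∈v var x
    at-arg : ∀ {f ts} (i : Fin (ar f)) → x ∈v ts i → x ∈v fun f ts

  IsVar : Term → Set
  IsVar t = Σ V (λ x → t ≡ var x)

  record Rule : Set where
    field
      deg      : Ω
      lhs      : Term
      rhs      : Term
      lhs-nvar : ¬ IsVar lhs
      vars⊆    : ∀ x → x ∈v rhs → x ∈v lhs

module _ (Q : Quantale) (G : GradeSet Q) where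
  record TRS : Set₁ where
    field
      sig   : Signature Q G
    open Terms sig public
    field
      RIdx  : Set
      rule  : RIdx → Rule

module TRSDefs {Q : Quantale} {G : GradeSet Q} (𝓡 : TRS Q G) where
  open Quantale Q
  open TRS 𝓡
  open Signature sig
  open Rule

  Step : Ω → Term → Term → Set
  Step γ a b =
    Σ RIdx λ ρ → Σ (V → Term) λ σ → Σ Term λ u → Σ (Pos u) λ p →
      (a ≡ replace u p (lhs (rule ρ) [ σ ])) ×
      (b ≡ replace u p (rhs (rule ρ) [ σ ])) ×
      (γ ≡ ∂ u p (deg (rule ρ)))

  data Sym-Step (γ : Ω) (u u' : Term) : Set where
    fwd : Step γ u u' → Sym-Step γ u u'
    bwd : Step γ u' u → Sym-Step γ u u'

  data Conv : Ω → Term → Term → Set where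
    nil  : ∀ {t} → Conv κ t t
    cons : ∀ {γ ε t u s} → Sym-Step γ t u → Conv ε u s → Conv (γ ⊗ ε) t s

  data _⊩_=R_ : Ω → Term → Term → Set where
    ax    : ∀ ρ → deg (rule ρ) ⊩ lhs (rule ρ) =R rhs (rule ρ)
    refl' : ∀ {t} → κ ⊩ t =R t
    sym'  : ∀ {ε t s} → ε ⊩ t =R s → ε ⊩ s =R t
    trans' : ∀ {ε δ t s r} → ε ⊩ t =R s → δ ⊩ s =R r → (ε ⊗ δ) ⊩ t =R r
    ampl  : ∀ {f} {ts ss : Fin (ar f) → Term} {εs : Fin (ar f) → Ω} →
            (∀ i → εs i ⊩ ts i =R ss i) →
            ⨂ Q (ar f) (λ i → modal f i (εs i)) ⊩ fun f ts =R fun f ss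
    subst' : ∀ {ε t s} (σ : V → Term) → ε ⊩ t =R s → ε ⊩ (t [ σ ]) =R (s [ σ ])
    ord   : ∀ {ε δ t s} → ε ⊩ t =R s → δ ≾ ε → δ ⊩ t =R s
    join  : ∀ {t s} n (εs : Fin n → Ω) → (∀ i → εs i ⊩ t =R s) →
            ⋁ εs ⊩ t =R s

{-# OPTIONS --safe #-}
module Submission where

-- A rewrite step of degree ∂ₚ(u)(ε) is an instance of a rule of degree ε,
-- closed by (Subst) and then lifted through the context u[_]ₚ one symbol at
-- a time by (Ampl): the rewritten argument contributes φᵢ(δ), every other
-- argument is related to itself by (Refl) at degree κ, and as CBEs preserve
-- κ the tensor collapses to φᵢ(δ). Chaining steps with (Trans) and (Sym)
-- gives t =_R s at the product degree ε, and one more (Sym) gives s =_R t.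

open import Defs
open import Data.Nat using (ℕ; zero; suc)
open import Data.Fin using (Fin; zero; suc; _≟_)
open import Data.Fin.Properties using (suc-injective)
open import Data.Product using (_,_)
open import Function using (_∘_)
open import Relation.Nullary using (yes; no; contradiction)
open import Relation.Binary.PropositionalEquality

module _ (Q : Quantale) where
  open Quantale Q

  ⊗-identityʳ : ∀ a → a ⊗ κ ≡ a
  ⊗-identityʳ a = trans (⊗-comm a κ) (⊗-identityˡ a)

  ⨂-κ : ∀ n (g : Fin n → Ω) → (∀ j → g j ≡ κ) → ⨂ Q n g ≡ κ
  ⨂-κ zero    g g≡κ = refl
  ⨂-κ (suc n) g g≡κ = begin
    g zero ⊗ ⨂ Q n (g ∘ suc) ≡⟨ cong₂ _⊗_ (g≡κ zero) (⨂-κ n (g ∘ suc) (g≡κ ∘ suc)) ⟩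
    κ ⊗ κ                    ≡⟨ ⊗-identityˡ κ ⟩
    κ                        ∎
    where open ≡-Reasoning

  ⨂-κ-except : ∀ n (g : Fin n → Ω) (i : Fin n) →
               (∀ j → j ≢ i → g j ≡ κ) → ⨂ Q n g ≡ g i
  ⨂-κ-except (suc n) g zero g≡κ = begin
    g zero ⊗ ⨂ Q n (g ∘ suc) ≡⟨ cong (g zero ⊗_) (⨂-κ n (g ∘ suc) (λ j → g≡κ (suc j) λ ())) ⟩
    g zero ⊗ κ               ≡⟨ ⊗-identityʳ (g zero) ⟩
    g zero                   ∎
    where open ≡-Reasoning
  ⨂-κ-except (suc n) g (suc i) g≡κ = begin
    g zero ⊗ ⨂ Q n (g ∘ suc) ≡⟨ cong (_⊗ ⨂ Q n (g ∘ suc)) (g≡κ zero λ ()) ⟩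
    κ ⊗ ⨂ Q n (g ∘ suc)      ≡⟨ ⊗-identityˡ _ ⟩
    ⨂ Q n (g ∘ suc)          ≡⟨ ⨂-κ-except n (g ∘ suc) i (λ j j≢i → g≡κ (suc j) (j≢i ∘ suc-injective)) ⟩
    g (suc i)                ∎
    where open ≡-Reasoning

module _ {Q : Quantale} {G : GradeSet Q} (𝓡 : TRS Q G) where
  open Quantale Q
  open GradeSet G
  open TRS 𝓡
  open TRSDefs 𝓡
  open Signature sig

  arity : Term → ℕ
  arity (var _)   = 0
  arity (fun f _) = ar f

  -- Lets us name the arguments of u[t]ₚ, which Defs builds in an anonymous where-block.
  arguments : (t : Term) → Fin (arity t) → Term
  arguments (fun _ ts) = ts

  =R-replace : ∀ {ε a b} (u : Term) (p : Pos u) → ε ⊩ a =R b →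
               ∂ u p ε ⊩ replace u p a =R replace u p b
  =R-replace u here a=b = a=b
  =R-replace {ε} {a} {b} (fun f ts) (there i p) a=b =
    subst (_⊩ _ =R _) ampl-degree (ampl argument-equations)
    where
      δ : Ω
      δ = ∂ (ts i) p ε

      εs : Fin (ar f) → Ω
      εs j with j ≟ i
      ... | yes _ = δ
      ... | no  _ = κ

      argument-equations : ∀ j → εs j ⊩ arguments (replace (fun f ts) (there i p) a) j
                                      =R arguments (replace (fun f ts) (there i p) b) j
      argument-equations j with j ≟ i
      ... | yes refl = =R-replace (ts i) p a=b
      ... | no  _    = refl'

      εs-at-i : εs i ≡ δ
      εs-at-i with i ≟ i
      ... | yes _   = refl
      ... | no  i≢i = contradiction refl i≢i

      modal-κ-except : ∀ j → j ≢ i → modal f j (εs j) ≡ κ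
      modal-κ-except j j≢i with j ≟ i
      ... | yes j≡i = contradiction j≡i j≢i
      ... | no  _   = IsCBE.pres-κ (Φ-CBE (modal-Φ f j))

      ampl-degree : ⨂ Q (ar f) (λ j → modal f j (εs j)) ≡ modal f i δ
      ampl-degree = trans (⨂-κ-except Q (ar f) _ i modal-κ-except)
                          (cong (modal f i) εs-at-i)

  Step⇒=R : ∀ {γ a b} → Step γ a b → γ ⊩ a =R b
  Step⇒=R (ρ , σ , u , p , refl , refl , refl) = =R-replace u p (subst' σ (ax ρ))

  Sym-Step⇒=R : ∀ {γ a b} → Sym-Step γ a b → γ ⊩ a =R b
  Sym-Step⇒=R (fwd step) = Step⇒=R step
  Sym-Step⇒=R (bwd step) = sym' (Step⇒=R step)

  Conv⇒=R : ∀ {ε t s} → Conv ε t s → ε ⊩ t =R s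
  Conv⇒=R nil             = refl'
  Conv⇒=R (cons step conv) = trans' (Sym-Step⇒=R step) (Conv⇒=R conv)

lemma3 : (Q : Quantale) (G : GradeSet Q) (𝓡 : TRS Q G) →
         let open TRS 𝓡 in let open TRSDefs 𝓡 in
         (t s : Term) (ε : Quantale.Ω Q) →
         Conv ε t s → ε ⊩ s =R t
lemma3 Q G 𝓡 t s ε conv = TRSDefs.sym' (Conv⇒=R 𝓡 conv)
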